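{- (i) For paths $P_m,P_n$ with $m\geq 2$ and $n\geq 2$, $D'(P_m\boxtimes P_n)=2$, except that $D'(P_2\boxtimes P_2)=3$. (ii) For cycles $C_m,C_n$ with $m\geq 3$ and $n\geq 3$, $D'(C_m\boxtimes C_n)=2$. (iii) For $m\geq 2$ and $n\geq 3$, $D'(P_m\boxtimes C_n)=2$.
   Context: $P_k$ denotes the path on $k$ vertices and $C_k$ the cycle on $k$ vertices. The distinguishing index $D'(G)$ of a graph $G$ is the least integer $d$ such that $G$ has an edge labeling with $d$ labels that is preserved only by the trivial automorphism. The strong product $G\boxtimes H$ has vertex set $V(G)\times V(H)$, with $(g,h)\sim(g',h')$ iff $(g,h)\neq(g',h')$ and ($g=g'$ or $gg'\in E(G)$) and ($h=h'$ or $hh'\in E(H)$). -}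

module Defs where

open import Data.Nat using (ℕ; zero; suc; _≤_)
open import Data.Fin using (Fin; toℕ)
open import Data.Product using (_×_; _,_; Σ; proj₁; proj₂)
open import Data.Sum using (_⊎_)
open import Relation.Nullary using (¬_)
open import Relation.Binary.PropositionalEquality using (_≡_)

record Graph : Set₁ where
  field
    V   : Set
    Adj : V → V → Set
open Graph public

PathAdj : (k : ℕ) → Fin k → Fin k → Set
PathAdj k i j = (suc (toℕ i) ≡ toℕ j) ⊎ (suc (toℕ j) ≡ toℕ i)

P : ℕ → Graph
P k = record { V = Fin k ; Adj = PathAdj k }

-- Cycle C_k on vertices 0..k-1 (intended for k ≥ 3): path edges plus the edge {0, k-1}.
CycleAdj : (k : ℕ) → Fin k → Fin k → Set
CycleAdj k i j = PathAdj k i j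
               ⊎ ((toℕ i ≡ 0 × suc (toℕ j) ≡ k) ⊎ (toℕ j ≡ 0 × suc (toℕ i) ≡ k))

C : ℕ → Graph
C k = record { V = Fin k ; Adj = CycleAdj k }

_⊠_ : Graph → Graph → Graph
G ⊠ H = record
  { V   = V G × V H
  ; Adj = λ x y → ¬ (x ≡ y)
                × (proj₁ x ≡ proj₁ y ⊎ Adj G (proj₁ x) (proj₁ y))
                × (proj₂ x ≡ proj₂ y ⊎ Adj H (proj₂ x) (proj₂ y))
  }

record Automorphism (G : Graph) : Set where
  field
    to       : V G → V G
    from     : V G → V G
    to-from  : ∀ v → to (from v) ≡ v
    from-to  : ∀ v → from (to v) ≡ v
    adj-to   : ∀ u v → Adj G u v → Adj G (to u) (to v)
    adj-from : ∀ u v → Adj G (to u) (to v) → Adj G u v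
open Automorphism public

-- An edge labeling with d labels: a label for each (unordered) edge,
-- represented as a function on vertex pairs that is symmetric on edges
-- (values on non-edges are irrelevant).
record EdgeLabeling (G : Graph) (d : ℕ) : Set where
  field
    lab     : V G → V G → Fin d
    lab-sym : ∀ u v → Adj G u v → lab u v ≡ lab v u
open EdgeLabeling public

Preserves : {G : Graph} {d : ℕ} → Automorphism G → EdgeLabeling G d → Set
Preserves {G} f c = ∀ u v → Adj G u v → lab c (to f u) (to f v) ≡ lab c u v

Distinguishing : {G : Graph} {d : ℕ} → EdgeLabeling G d → Set
Distinguishing {G} c = (f : Automorphism G) → Preserves f c → ∀ v → to f v ≡ v

HasDistinguishingEdgeLabeling : Graph → ℕ → Set
HasDistinguishingEdgeLabeling G d = Σ (EdgeLabeling G d) Distinguishing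

DistinguishingIndexIs : Graph → ℕ → Set
DistinguishingIndexIs G d =
  HasDistinguishingEdgeLabeling G d × (∀ d' → HasDistinguishingEdgeLabeling G d' → d ≤ d')

-- One label never suffices: reversing the first factor is a non-trivial automorphism.
-- Two labels suffice because the strong grid P_m ⊠ P_n, and with it its spanning
-- supergraphs C_m ⊠ C_n and P_m ⊠ C_n, has a Hamiltonian path v₀ v₁ … v_{N-1} in which
-- v₁v₃ is an edge as well: zigzag through the first two rows column by column, then snake
-- through the remaining rows.  Label the path edges and the chord v₁v₃ with 1, all other
-- edges with 0.  An automorphism preserving the labels induces an automorphism of the path
-- with the chord {1,3}, and for N ≥ 6 that graph is asymmetric: of its two leaves, v₀
-- hangs off the triangle v₁v₂v₃ while v_{N-1} is attached to a vertex of degree two.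
-- For P₂ ⊠ P₂ = K₄ both remaining facts, that every 2-labeling is preserved by a
-- non-trivial involution and that a particular 3-labeling is distinguishing, are finite
-- and are decided by evaluation.
module Submission where

open import Defs
open import Data.Empty using (⊥; ⊥-elim)
open import Data.Fin using (Fin; zero; suc; toℕ; opposite; combine; remQuot; splitAt; _↑ˡ_; _↑ʳ_)
open import Data.Fin.Patterns using (0F; 1F; 2F)
open import Data.Fin.Properties
  using (toℕ<n; toℕ-injective; toℕ-fromℕ<; toℕ-↑ˡ; toℕ-↑ʳ; toℕ-combine; opposite-prop; opposite-involutive;
         combine-remQuot; remQuot-combine; splitAt-↑ˡ; splitAt-↑ʳ; splitAt⁻¹-↑ˡ; splitAt⁻¹-↑ʳ; all?; any?)
  renaming (_≟_ to _≟ᶠ_)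
open import Data.Nat using (ℕ; zero; suc; _+_; _*_; _∸_; _≤_; _<_; z≤n; s≤s; NonZero; >-nonZero; _<?_)
  renaming (_≟_ to _≟ℕ_)
open import Data.Nat.DivMod using (_mod_; m<n⇒m%n≡m)
open import Data.Nat.Properties
  using (≤-reflexive; ≤-trans; ≤-antisym; <-trans; <⇒≤; <⇒≱; <-irrefl; n<1+n; n≤1+n; n≤0⇒n≡0; m≤m+n;
         m≤n⇒m<n∨m≡n; m≤n⇒∃[o]m+o≡n; suc-injective; +-suc; +-assoc; +-comm; +-identityʳ; +-cancelˡ-≡;
         +-cancelˡ-≤; *-suc; *-zeroʳ; *-comm; +-∸-assoc; n∸n≡0; m∸n≡0⇒m≤n; module ≤-Reasoning)
open import Data.Product using (_×_; _,_; proj₁; proj₂; ∃; map₁; map₂; uncurry; curry)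
open import Data.Product.Properties using (≡-dec)
open import Data.Sum using (_⊎_; inj₁; inj₂; [_,_]′)
import Data.Sum as Sum
open import Function using (_∘_)
open import Function.Bundles using (_↔_; Inverse; mk↔ₛ′)
open import Relation.Nullary using (¬_; Dec; yes; no)
open import Relation.Nullary.Decidable using (_⊎-dec_; _×-dec_; _→-dec_; ¬?; map′; True; toWitness)
open import Relation.Binary.PropositionalEquality
  using (_≡_; _≢_; refl; sym; trans; cong; cong₂; subst; subst₂; module ≡-Reasoning)

Asymmetric : Graph → Set
Asymmetric G = (f : Automorphism G) → ∀ v → to f v ≡ v

to-injective : ∀ {G} (f : Automorphism G) {u v} → to f u ≡ to f v → u ≡ v
to-injective f {u} {v} e = trans (sym (from-to f u)) (trans (cong (from f) e) (from-to f v))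

involution : (G : Graph) (π : V G → V G) → (∀ v → π (π v) ≡ v)
           → (∀ {u v} → Adj G u v → Adj G (π u) (π v)) → Automorphism G
involution G π π-involutive π-adj = record
  { to       = π
  ; from     = π
  ; to-from  = π-involutive
  ; from-to  = π-involutive
  ; adj-to   = λ _ _ → π-adj
  ; adj-from = λ u v a → subst₂ (Adj G) (π-involutive u) (π-involutive v) (π-adj a)
  }

⊠-mapˡ : ∀ {A} (B : Graph) → Automorphism A → Automorphism (A ⊠ B)
⊠-mapˡ B f = record
  { to       = map₁ (to f)
  ; from     = map₁ (from f)
  ; to-from  = λ (x , y) → cong (_, y) (to-from f x)
  ; from-to  = λ (x , y) → cong (_, y) (from-to f x)
  ; adj-to   = λ (x , _) (x′ , _) (u≢v , a , b) →
                 (λ e → u≢v (cong₂ _,_ (to-injective f (cong proj₁ e)) (cong proj₂ e)))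
               , Sum.map (cong (to f)) (adj-to f x x′) a , b
  ; adj-from = λ (x , _) (x′ , _) (u≢v , a , b) →
                 u≢v ∘ cong (map₁ (to f)) , Sum.map (to-injective f) (adj-from f x x′) a , b
  }

moved⇒2≤labels : ∀ {G d} (f : Automorphism G) {v} → to f v ≢ v → HasDistinguishingEdgeLabeling G d → 2 ≤ d
moved⇒2≤labels {d = 0} _ {v} _ (c , _) with lab c v v
... | ()
moved⇒2≤labels {d = 1} f {v} moved (c , distinguishing) = ⊥-elim (moved (distinguishing f preserved v))
  where
  preserved : Preserves f c
  preserved u w _ with lab c (to f u) (to f w) | lab c u w
  ... | 0F | 0F = refl
moved⇒2≤labels {d = suc (suc _)} _ _ _ = s≤s (s≤s z≤n)

distinguishingIndex≡2 : ∀ {G} → HasDistinguishingEdgeLabeling G 2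
                      → (f : Automorphism G) {v : V G} → to f v ≢ v → DistinguishingIndexIs G 2
distinguishingIndex≡2 c f moved = c , λ _ → moved⇒2≤labels f moved

opposite-reverses-suc : ∀ {k} {i j : Fin k} → suc (toℕ i) ≡ toℕ j → suc (toℕ (opposite j)) ≡ toℕ (opposite i)
opposite-reverses-suc {k} {i} {j} e = begin
  suc (toℕ (opposite j))  ≡⟨ cong suc (opposite-prop j) ⟩
  suc (k ∸ suc (toℕ j))   ≡⟨ +-∸-assoc 1 (toℕ<n j) ⟨
  k ∸ toℕ j               ≡⟨ cong (k ∸_) e ⟨
  k ∸ suc (toℕ i)         ≡⟨ opposite-prop i ⟨
  toℕ (opposite i)        ∎
  where open ≡-Reasoning

opposite-zero⇒last : ∀ {k} {i : Fin k} → toℕ (opposite i) ≡ 0 → suc (toℕ i) ≡ k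
opposite-zero⇒last {i = i} e = ≤-antisym (toℕ<n i) (m∸n≡0⇒m≤n (trans (sym (opposite-prop i)) e))

last⇒opposite-zero : ∀ {k} {i : Fin k} → suc (toℕ i) ≡ k → toℕ (opposite i) ≡ 0
last⇒opposite-zero {k} {i} e = trans (opposite-prop i) (trans (cong (k ∸_) e) (n∸n≡0 k))

zero⇒opposite-last : ∀ {k} {i : Fin k} → toℕ i ≡ 0 → suc (toℕ (opposite i)) ≡ k
zero⇒opposite-last {i = i} e = opposite-zero⇒last (trans (cong toℕ (opposite-involutive i)) e)

opposite-pathAdj : ∀ {k} {i j : Fin k} → PathAdj k i j → PathAdj k (opposite i) (opposite j)
opposite-pathAdj (inj₁ e) = inj₂ (opposite-reverses-suc e)
opposite-pathAdj (inj₂ e) = inj₁ (opposite-reverses-suc e)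

opposite-cycleAdj : ∀ {k} {i j : Fin k} → CycleAdj k i j → CycleAdj k (opposite i) (opposite j)
opposite-cycleAdj (inj₁ a)                     = inj₁ (opposite-pathAdj a)
opposite-cycleAdj (inj₂ (inj₁ (i≡0 , j-last))) = inj₂ (inj₂ (last⇒opposite-zero j-last , zero⇒opposite-last i≡0))
opposite-cycleAdj (inj₂ (inj₂ (j≡0 , i-last))) = inj₂ (inj₁ (last⇒opposite-zero i-last , zero⇒opposite-last j≡0))

reverse-path : ∀ k → Automorphism (P k)
reverse-path k = involution (P k) opposite opposite-involutive opposite-pathAdj

reverse-cycle : ∀ k → Automorphism (C k)
reverse-cycle k = involution (C k) opposite opposite-involutive opposite-cycleAdj

-- Distinguishing labelings from asymmetric spanning subgraphs

indicator : ∀ {A : Set} → Dec A → Fin 2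
indicator (yes _) = 1F
indicator (no _)  = 0F

indicator-yes : ∀ {A : Set} (a? : Dec A) → A → indicator a? ≡ 1F
indicator-yes (yes _) _ = refl
indicator-yes (no ¬a) a = ⊥-elim (¬a a)

indicator-1 : ∀ {A : Set} (a? : Dec A) → indicator a? ≡ 1F → A
indicator-1 (yes a) _ = a

indicator-cong : ∀ {A B : Set} → (A → B) → (B → A) → (a? : Dec A) (b? : Dec B) → indicator a? ≡ indicator b?
indicator-cong _   _   (yes _) (yes _) = refl
indicator-cong _   _   (no _)  (no _)  = refl
indicator-cong A→B _   (yes a) (no ¬b) = ⊥-elim (¬b (A→B a))
indicator-cong _   B→A (no ¬a) (yes b) = ⊥-elim (¬a (B→A b))

module _ (S G : Graph) (adj? : ∀ i j → Dec (Adj S i j)) (adj-sym : ∀ {i j} → Adj S i j → Adj S j i)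
         (S-asymmetric : Asymmetric S) (e : V S ↔ V G)
         (embed : ∀ {i j} → Adj S i j → Adj G (Inverse.to e i) (Inverse.to e j)) where
  private
    module e = Inverse e

    spanning-labeling : EdgeLabeling G 2
    spanning-labeling = record
      { lab     = λ u v → indicator (adj? (e.from u) (e.from v))
      ; lab-sym = λ u v _ → indicator-cong adj-sym adj-sym _ _
      }

    lab-embed : ∀ i j → lab spanning-labeling (e.to i) (e.to j) ≡ indicator (adj? i j)
    lab-embed i j = cong₂ (λ x y → indicator (adj? x y)) (e.strictlyInverseʳ i) (e.strictlyInverseʳ j)

    induced : (f : Automorphism G) → Preserves f spanning-labeling → Automorphism S
    induced f preserves = record
      { to       = e.from ∘ to f ∘ e.to
      ; from     = e.from ∘ from f ∘ e.to
      ; to-from  = λ i → trans (cong (e.from ∘ to f) (e.strictlyInverseˡ _))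
                               (trans (cong e.from (to-from f _)) (e.strictlyInverseʳ i))
      ; from-to  = λ i → trans (cong (e.from ∘ from f) (e.strictlyInverseˡ _))
                               (trans (cong e.from (from-to f _)) (e.strictlyInverseʳ i))
      ; adj-to   = λ i j a → indicator-1 (adj? _ _)
                     (trans (preserves _ _ (embed a)) (trans (lab-embed i j) (indicator-yes _ a)))
      ; adj-from = λ i j a → indicator-1 (adj? i j)
                     (trans (sym (lab-embed i j)) (trans (sym (preserves _ _ (adj-from f _ _
                       (subst₂ (Adj G) (e.strictlyInverseˡ _) (e.strictlyInverseˡ _) (embed a)))))
                       (indicator-yes _ a)))
      }

    spanning-distinguishing : Distinguishing spanning-labeling
    spanning-distinguishing f preserves v = begin
      to f v                                      ≡⟨ cong (to f) (e.strictlyInverseˡ v) ⟨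
      to f (e.to (e.from v))                      ≡⟨ e.strictlyInverseˡ _ ⟨
      e.to (to (induced f preserves) (e.from v))  ≡⟨ cong e.to (S-asymmetric (induced f preserves) (e.from v)) ⟩
      e.to (e.from v)                             ≡⟨ e.strictlyInverseˡ v ⟩
      v                                           ∎
      where open ≡-Reasoning

  asymmetric-spanning⇒distinguishing₂ : HasDistinguishingEdgeLabeling G 2
  asymmetric-spanning⇒distinguishing₂ = spanning-labeling , spanning-distinguishing

-- The path with the chord {1,3}

Step : ℕ → ℕ → Set
Step i j = suc i ≡ j ⊎ (i ≡ 1 × j ≡ 3)

Link : ℕ → ℕ → Set
Link i j = Step i j ⊎ Step j i

link? : ∀ i j → Dec (Link i j)
link? i j = step? i j ⊎-dec step? j i
  where
  step? : ∀ i j → Dec (Step i j)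
  step? i j = (suc i ≟ℕ j) ⊎-dec ((i ≟ℕ 1) ×-dec (j ≟ℕ 3))

link-sym : ∀ {i j} → Link i j → Link j i
link-sym = Sum.swap

forward : ∀ i → Link i (suc i)
forward i = inj₁ (inj₁ refl)

backward : ∀ i → Link (suc i) i
backward i = inj₂ (inj₁ refl)

chord : Link 1 3
chord = inj₁ (inj₂ (refl , refl))

ChordedPath : ℕ → Graph
ChordedPath N = record { V = Fin N ; Adj = λ i j → Link (toℕ i) (toℕ j) }

link-0 : ∀ {j} → Link 0 j → j ≡ 1
link-0 (inj₁ (inj₁ refl)) = refl
link-0 (inj₁ (inj₂ (() , _)))
link-0 (inj₂ (inj₁ ()))
link-0 (inj₂ (inj₂ (_ , ())))

link-1 : ∀ {j} → Link 1 j → j ≡ 0 ⊎ j ≡ 2 ⊎ j ≡ 3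
link-1 (inj₁ (inj₁ refl))          = inj₂ (inj₁ refl)
link-1 (inj₁ (inj₂ (refl , refl))) = inj₂ (inj₂ refl)
link-1 (inj₂ (inj₁ refl))          = inj₁ refl
link-1 (inj₂ (inj₂ (_ , ())))

link-2 : ∀ {j} → Link 2 j → j ≡ 1 ⊎ j ≡ 3
link-2 (inj₁ (inj₁ refl)) = inj₂ refl
link-2 (inj₁ (inj₂ (() , _)))
link-2 (inj₂ (inj₁ refl)) = inj₁ refl
link-2 (inj₂ (inj₂ (_ , ())))

link-3 : ∀ {j} → Link 3 j → j ≡ 1 ⊎ j ≡ 2 ⊎ j ≡ 4
link-3 (inj₁ (inj₁ refl))          = inj₂ (inj₂ refl)
link-3 (inj₁ (inj₂ (() , _)))
link-3 (inj₂ (inj₁ refl))          = inj₂ (inj₁ refl)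
link-3 (inj₂ (inj₂ (refl , refl))) = inj₁ refl

link-tail : ∀ {k j} → Link (4 + k) j → j ≡ 3 + k ⊎ j ≡ 5 + k
link-tail (inj₁ (inj₁ refl)) = inj₂ refl
link-tail (inj₁ (inj₂ (() , _)))
link-tail (inj₂ (inj₁ refl)) = inj₁ refl
link-tail (inj₂ (inj₂ (_ , ())))

unique-neighbour⇒end : ∀ {N p x} → p < N → (∀ {a} → a < N → Link p a → a ≡ x) → p ≡ 0 ⊎ suc p ≡ N
unique-neighbour⇒end {p = zero}  _   _      = inj₁ refl
unique-neighbour⇒end {p = suc q} p<N unique with m≤n⇒m<n∨m≡n p<N
... | inj₂ last  = inj₂ last
... | inj₁ p+1<N = ⊥-elim (q≢2+q (trans (unique (<-trans (n<1+n q) p<N) (backward q))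
                                          (sym (unique p+1<N (forward (suc q))))))
  where
  q≢2+q : q ≢ suc (suc q)
  q≢2+q ()

pigeonhole : ∀ {A : Set} {a b x y z : A} → x ≡ a ⊎ x ≡ b → y ≡ a ⊎ y ≡ b → z ≡ a ⊎ z ≡ b
           → x ≢ y → x ≢ z → y ≢ z → ⊥
pigeonhole (inj₁ refl) (inj₁ refl) _           x≢y _   _   = x≢y refl
pigeonhole (inj₂ refl) (inj₂ refl) _           x≢y _   _   = x≢y refl
pigeonhole (inj₁ refl) (inj₂ refl) (inj₁ refl) _   x≢z _   = x≢z refl
pigeonhole (inj₁ refl) (inj₂ refl) (inj₂ refl) _   _   y≢z = y≢z refl
pigeonhole (inj₂ refl) (inj₁ refl) (inj₁ refl) _   _   y≢z = y≢z refl
pigeonhole (inj₂ refl) (inj₁ refl) (inj₂ refl) _   x≢z _   = x≢z refl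

private
  module ChordedPathRigidity {N : ℕ} (6≤N : 6 ≤ N) (f : Automorphism (ChordedPath N)) where
    instance
      N-nonZero : NonZero N
      N-nonZero = >-nonZero (≤-trans (s≤s z≤n) 6≤N)

    below : ∀ i {_ : True (i <? 6)} → i < N
    below i {i<6} = ≤-trans (toWitness i<6) 6≤N

    -- meaningful for i < N only
    vertex : ℕ → Fin N
    vertex i = i mod N

    toℕ-vertex : ∀ {i} → i < N → toℕ (vertex i) ≡ i
    toℕ-vertex i<N = trans (toℕ-fromℕ< _) (m<n⇒m%n≡m i<N)

    vertex-toℕ : ∀ v → vertex (toℕ v) ≡ v
    vertex-toℕ v = toℕ-injective (toℕ-vertex (toℕ<n v))

    σ σ⁻¹ : ℕ → ℕ
    σ i   = toℕ (to f (vertex i))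
    σ⁻¹ i = toℕ (from f (vertex i))

    σ∘σ⁻¹ : ∀ {i} → i < N → σ (σ⁻¹ i) ≡ i
    σ∘σ⁻¹ i<N = trans (cong (toℕ ∘ to f) (vertex-toℕ _)) (trans (cong toℕ (to-from f _)) (toℕ-vertex i<N))

    σ-distinct : ∀ {i j} → i < N → j < N → i ≢ j → σ i ≢ σ j
    σ-distinct {i} {j} i<N j<N i≢j e = i≢j (begin
      i                ≡⟨ toℕ-vertex i<N ⟨
      toℕ (vertex i)   ≡⟨ cong toℕ (to-injective f (toℕ-injective e)) ⟩
      toℕ (vertex j)   ≡⟨ toℕ-vertex j<N ⟩
      j                ∎)
      where open ≡-Reasoning

    clash : ∀ {i j x} → i < N → j < N → i ≢ j → σ i ≡ x → σ j ≡ x → ⊥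
    clash i<N j<N i≢j e e′ = σ-distinct i<N j<N i≢j (trans e (sym e′))

    σ-link : ∀ {i j} → i < N → j < N → Link i j → Link (σ i) (σ j)
    σ-link i<N j<N l = adj-to f _ _ (subst₂ Link (sym (toℕ-vertex i<N)) (sym (toℕ-vertex j<N)) l)

    σ-link⁻ : ∀ {i j} → i < N → j < N → Link (σ i) (σ j) → Link i j
    σ-link⁻ i<N j<N l = subst₂ Link (toℕ-vertex i<N) (toℕ-vertex j<N) (adj-from f _ _ l)

    neighbour : ∀ {i j x} → i < N → j < N → σ i ≡ x → Link i j → Link x (σ j)
    neighbour i<N j<N e l = subst (λ y → Link y _) e (σ-link i<N j<N l)

    σ0-unique-neighbour : ∀ {a} → a < N → Link (σ 0) a → a ≡ σ 1
    σ0-unique-neighbour {a} a<N l = begin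
      a          ≡⟨ σ∘σ⁻¹ a<N ⟨
      σ (σ⁻¹ a)  ≡⟨ cong σ (link-0 (σ-link⁻ (below 0) (toℕ<n _)
                                     (subst (Link (σ 0)) (sym (σ∘σ⁻¹ a<N)) l))) ⟩
      σ 1        ∎
      where open ≡-Reasoning

    σ0-not-last : suc (σ 0) ≢ N
    σ0-not-last last = pigeonhole (around (below 0) (backward 0)) (around (below 2) (forward 1)) (around (below 3) chord)
      (σ-distinct (below 0) (below 2) (λ ())) (σ-distinct (below 0) (below 3) (λ ()))
      (σ-distinct (below 2) (below 3) (λ ()))
      where
      k = proj₁ (m≤n⇒∃[o]m+o≡n 6≤N)
      6+k≡N = proj₂ (m≤n⇒∃[o]m+o≡n 6≤N)

      σ1≡4+k : σ 1 ≡ 4 + k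
      σ1≡4+k with link-tail (neighbour (below 0) (below 1) (suc-injective (trans last (sym 6+k≡N))) (forward 0))
      ... | inj₁ σ1≡4+k = σ1≡4+k
      ... | inj₂ σ1≡6+k = ⊥-elim (<-irrefl (trans σ1≡6+k 6+k≡N) (toℕ<n _))

      around : ∀ {i} → i < N → Link 1 i → σ i ≡ 3 + k ⊎ σ i ≡ 5 + k
      around i<N l = link-tail (neighbour (below 1) i<N σ1≡4+k l)

    σ0≡0 : σ 0 ≡ 0
    σ0≡0 with unique-neighbour⇒end (toℕ<n _) σ0-unique-neighbour
    ... | inj₁ σ0≡0 = σ0≡0
    ... | inj₂ last = ⊥-elim (σ0-not-last last)

    σ1≡1 : σ 1 ≡ 1
    σ1≡1 = link-0 (neighbour (below 0) (below 1) σ0≡0 (forward 0))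

    σ3≡3 : σ 3 ≡ 3
    σ3≡3 with link-1 (neighbour (below 1) (below 3) σ1≡1 chord)
    ... | inj₁ σ3≡0        = ⊥-elim (clash (below 3) (below 0) (λ ()) σ3≡0 σ0≡0)
    ... | inj₂ (inj₂ σ3≡3) = σ3≡3
    ... | inj₂ (inj₁ σ3≡2) with link-2 (neighbour (below 3) (below 4) σ3≡2 (forward 3))
    ...   | inj₁ σ4≡1 = ⊥-elim (clash (below 4) (below 1) (λ ()) σ4≡1 σ1≡1)
    ...   | inj₂ σ4≡3 with link-1 (neighbour (below 1) (below 2) σ1≡1 (forward 1))
    ...     | inj₁ σ2≡0        = ⊥-elim (clash (below 2) (below 0) (λ ()) σ2≡0 σ0≡0)
    ...     | inj₂ (inj₁ σ2≡2) = ⊥-elim (clash (below 2) (below 3) (λ ()) σ2≡2 σ3≡2)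
    ...     | inj₂ (inj₂ σ2≡3) = ⊥-elim (clash (below 2) (below 4) (λ ()) σ2≡3 σ4≡3)

    σ2≡2 : σ 2 ≡ 2
    σ2≡2 with link-1 (neighbour (below 1) (below 2) σ1≡1 (forward 1))
    ... | inj₁ σ2≡0        = ⊥-elim (clash (below 2) (below 0) (λ ()) σ2≡0 σ0≡0)
    ... | inj₂ (inj₁ σ2≡2) = σ2≡2
    ... | inj₂ (inj₂ σ2≡3) = ⊥-elim (clash (below 2) (below 3) (λ ()) σ2≡3 σ3≡3)

    σ4≡4 : σ 4 ≡ 4
    σ4≡4 with link-3 (neighbour (below 3) (below 4) σ3≡3 (forward 3))
    ... | inj₁ σ4≡1        = ⊥-elim (clash (below 4) (below 1) (λ ()) σ4≡1 σ1≡1)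
    ... | inj₂ (inj₁ σ4≡2) = ⊥-elim (clash (below 4) (below 2) (λ ()) σ4≡2 σ2≡2)
    ... | inj₂ (inj₂ σ4≡4) = σ4≡4

    σ-tail : ∀ d → 4 + d < N → σ (3 + d) ≡ 3 + d × σ (4 + d) ≡ 4 + d
    σ-tail zero    _     = σ3≡3 , σ4≡4
    σ-tail (suc d) 5+d<N with σ-tail d (<⇒≤ 5+d<N)
    ... | σ[3+d]≡3+d , σ[4+d]≡4+d with link-tail (neighbour (<⇒≤ 5+d<N) 5+d<N σ[4+d]≡4+d (forward (4 + d)))
    ...   | inj₁ σ[5+d]≡3+d = ⊥-elim (clash 5+d<N (<⇒≤ (<⇒≤ 5+d<N)) (λ ()) σ[5+d]≡3+d σ[3+d]≡3+d)
    ...   | inj₂ σ[5+d]≡5+d = σ[4+d]≡4+d , σ[5+d]≡5+d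

    σ-id : ∀ {i} → i < N → σ i ≡ i
    σ-id {0} _ = σ0≡0
    σ-id {1} _ = σ1≡1
    σ-id {2} _ = σ2≡2
    σ-id {3} _ = σ3≡3
    σ-id {suc (suc (suc (suc d)))} 4+d<N = proj₂ (σ-tail d 4+d<N)

chordedPath-asymmetric : ∀ {N} → 6 ≤ N → Asymmetric (ChordedPath N)
chordedPath-asymmetric 6≤N f v =
  toℕ-injective (trans (cong (toℕ ∘ to f) (sym (vertex-toℕ v))) (σ-id (toℕ<n v)))
  where open ChordedPathRigidity 6≤N f

-- Mixed-radix numerals

radix-suc-digit : ∀ b q r → b * suc q + r ≡ b + (b * q + r)
radix-suc-digit b q r = trans (cong (_+ r) (*-suc b q)) (+-assoc b (b * q) r)

radix-≥ : ∀ b q r → b ≤ b * suc q + r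
radix-≥ b q r = ≤-trans (m≤m+n b _) (≤-reflexive (sym (radix-suc-digit b q r)))

radix-injective : ∀ {b} q q′ {r r′} → r < b → r′ < b → b * q + r ≡ b * q′ + r′ → q ≡ q′ × r ≡ r′
radix-injective {b} zero    zero     _   _    e = refl , +-cancelˡ-≡ (b * 0) _ _ e
radix-injective {b} zero    (suc q′) {r} r<b _ e =
  ⊥-elim (<⇒≱ r<b (subst (b ≤_) (trans (sym e) (cong (_+ r) (*-zeroʳ b))) (radix-≥ b q′ _)))
radix-injective {b} (suc q) zero {r′ = r′} _ r′<b e =
  ⊥-elim (<⇒≱ r′<b (subst (b ≤_) (trans e (cong (_+ r′) (*-zeroʳ b))) (radix-≥ b q _)))
radix-injective {b} (suc q) (suc q′) r<b r′<b e = map₁ (cong suc) (radix-injective q q′ r<b r′<b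
  (+-cancelˡ-≡ b _ _ (trans (sym (radix-suc-digit b q _)) (trans e (radix-suc-digit b q′ _)))))

radix-suc : ∀ {b} q q′ {r r′} → r < b → r′ < b → b * q′ + r′ ≡ suc (b * q + r)
          → (q′ ≡ q × r′ ≡ suc r) ⊎ (q′ ≡ suc q × r′ ≡ 0 × suc r ≡ b)
radix-suc {b} q q′ {r} r<b r′<b e with m≤n⇒m<n∨m≡n r<b
... | inj₁ r+1<b = inj₁ (radix-injective q′ q r′<b r+1<b (trans e (sym (+-suc (b * q) r))))
... | inj₂ r+1≡b =
  inj₂ (map₂ (_, r+1≡b) (radix-injective q′ (suc q) r′<b (≤-trans (s≤s z≤n) r<b) (trans e carry)))
  where
  open ≡-Reasoning
  carry : suc (b * q + r) ≡ b * suc q + 0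
  carry = begin
    suc (b * q + r)  ≡⟨ +-suc (b * q) r ⟨
    b * q + suc r    ≡⟨ cong (b * q +_) r+1≡b ⟩
    b * q + b        ≡⟨ +-comm (b * q) b ⟩
    b + b * q        ≡⟨ *-suc b q ⟨
    b * suc q        ≡⟨ +-identityʳ _ ⟨
    b * suc q + 0    ∎

combine-suc : ∀ {a b} (i i′ : Fin a) (j j′ : Fin b) → toℕ (combine i′ j′) ≡ suc (toℕ (combine i j))
            → (toℕ i′ ≡ toℕ i × toℕ j′ ≡ suc (toℕ j))
            ⊎ (toℕ i′ ≡ suc (toℕ i) × toℕ j′ ≡ 0 × suc (toℕ j) ≡ b)
combine-suc i i′ j j′ e = radix-suc (toℕ i) (toℕ i′) (toℕ<n j) (toℕ<n j′)
  (trans (sym (toℕ-combine i′ j′)) (trans e (cong suc (toℕ-combine i j))))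

combine-last : ∀ {a b} (i : Fin a) (j : Fin b) → suc (toℕ (combine i j)) ≡ a * b
             → suc (toℕ i) ≡ a × suc (toℕ j) ≡ b
combine-last {a} {b} i j e
  with radix-suc (toℕ i) a (toℕ<n j) (≤-trans (s≤s z≤n) (toℕ<n j))
         (trans (+-identityʳ _) (trans (*-comm b a) (trans (sym e) (cong suc (toℕ-combine i j)))))
... | inj₁ (_ , ())
... | inj₂ (a≡i+1 , _ , j+1≡b) = sym a≡i+1 , j+1≡b

combine-first : ∀ {a b} (i : Fin a) (j : Fin b) → toℕ (combine i j) ≡ 0 → toℕ i ≡ 0 × toℕ j ≡ 0
combine-first {b = b} i j e = radix-injective (toℕ i) 0 (toℕ<n j) (≤-trans (s≤s z≤n) (toℕ<n j))
  (trans (sym (toℕ-combine i j)) (trans e (sym (trans (+-identityʳ (b * 0)) (*-zeroʳ b)))))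

-- A Hamiltonian path of the strong grid

turn : ∀ {n} → ℕ → Fin n → Fin n
turn zero    c = opposite c
turn (suc k) c = opposite (turn k c)

turn-opposite : ∀ {n} k (c : Fin n) → turn k (opposite c) ≡ opposite (turn k c)
turn-opposite zero    c = refl
turn-opposite (suc k) c = cong opposite (turn-opposite k c)

turn-involutive : ∀ {n} k (c : Fin n) → turn k (turn k c) ≡ c
turn-involutive zero    c = opposite-involutive c
turn-involutive (suc k) c = begin
  opposite (turn k (opposite (turn k c)))  ≡⟨ cong opposite (turn-opposite k _) ⟩
  opposite (opposite (turn k (turn k c)))  ≡⟨ opposite-involutive _ ⟩
  turn k (turn k c)                        ≡⟨ turn-involutive k c ⟩
  c                                        ∎
  where open ≡-Reasoning

turn-injective : ∀ {n} k {c c′ : Fin n} → turn k c ≡ turn k c′ → c ≡ c′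
turn-injective k {c} {c′} e = trans (sym (turn-involutive k c)) (trans (cong (turn k) e) (turn-involutive k c′))

turn-pathAdj : ∀ {n} k {c c′ : Fin n} → PathAdj n c c′ → PathAdj n (turn k c) (turn k c′)
turn-pathAdj zero    a = opposite-pathAdj a
turn-pathAdj (suc k) a = opposite-pathAdj (turn-pathAdj k a)

turn-pathAdj⁻ : ∀ {n} k {c c′ : Fin n} → PathAdj n (turn k c) (turn k c′) → PathAdj n c c′
turn-pathAdj⁻ k a = subst₂ (PathAdj _) (turn-involutive k _) (turn-involutive k _) (turn-pathAdj k a)

Near : ℕ → ℕ → Set
Near x y = x ≡ y ⊎ suc x ≡ y ⊎ suc y ≡ x

Close : (k : ℕ) → Fin k → Fin k → Set
Close k i j = i ≡ j ⊎ PathAdj k i j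

near⇒close : ∀ {k} {i j : Fin k} → Near (toℕ i) (toℕ j) → Close k i j
near⇒close = Sum.map₁ toℕ-injective

close-sym : ∀ {k} {i j : Fin k} → Close k i j → Close k j i
close-sym = Sum.map sym Sum.swap

path⊠path-sym : ∀ {a b} {u v} → Adj (P a ⊠ P b) u v → Adj (P a ⊠ P b) v u
path⊠path-sym (u≢v , r , c) = u≢v ∘ sym , close-sym r , close-sym c

path⊆cycle : ∀ {k} {i j : Fin k} → Close k i j → i ≡ j ⊎ CycleAdj k i j
path⊆cycle = Sum.map₂ inj₁

module Grid (m′ n′ : ℕ) where

  n N : ℕ
  n = 2 + n′
  N = n * 2 + m′ * n

  Cell : Set
  Cell = Fin (2 + m′) × Fin n

  PP : Graph
  PP = P (2 + m′) ⊠ P n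

  -- The position of a cell on the path: rows 0 and 1 are visited column by column,
  -- (a , c) at position 2c + a; then come the rows 2 + k one after another, column c
  -- at offset turn k c, so that the direction alternates starting from right to left.
  index : Cell → Fin N
  index (zero , c)        = combine {n} {2} c 0F ↑ˡ (m′ * n)
  index (suc zero , c)    = combine {n} {2} c 1F ↑ˡ (m′ * n)
  index (suc (suc k) , c) = (n * 2) ↑ʳ combine k (turn (toℕ k) c)

  private
    fromUpper : Fin n × Fin 2 → Cell
    fromUpper (c , a) = a ↑ˡ m′ , c

    fromLower : Fin m′ × Fin n → Cell
    fromLower (k , t) = 2 ↑ʳ k , turn (toℕ k) t

    fromBlock : Fin (n * 2) ⊎ Fin (m′ * n) → Cell
    fromBlock = [ fromUpper ∘ remQuot 2 , fromLower ∘ remQuot n ]′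

  cell : Fin N → Cell
  cell i = fromBlock (splitAt (n * 2) i)

  index-upper : ∀ a c → index (a ↑ˡ m′ , c) ≡ combine c a ↑ˡ (m′ * n)
  index-upper 0F c = refl
  index-upper 1F c = refl

  cell-index : ∀ v → cell (index v) ≡ v
  cell-index (zero , c) = trans (cong fromBlock (splitAt-↑ˡ (n * 2) (combine {n} {2} c 0F) (m′ * n)))
                                (cong fromUpper (remQuot-combine {k = 2} c 0F))
  cell-index (suc zero , c) = trans (cong fromBlock (splitAt-↑ˡ (n * 2) (combine {n} {2} c 1F) (m′ * n)))
                                    (cong fromUpper (remQuot-combine {k = 2} c 1F))
  cell-index (suc (suc k) , c) = trans (cong fromBlock (splitAt-↑ʳ (n * 2) (m′ * n) (combine k (turn (toℕ k) c))))
    (trans (cong fromLower (remQuot-combine k (turn (toℕ k) c))) (cong (suc (suc k) ,_) (turn-involutive (toℕ k) c)))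

  index-cell : ∀ i → index (cell i) ≡ i
  index-cell i with splitAt (n * 2) i in eq
  ... | inj₁ y = let (c , a) = remQuot {n} 2 y in
    trans (index-upper a c) (trans (cong (_↑ˡ (m′ * n)) (combine-remQuot {n} 2 y)) (splitAt⁻¹-↑ˡ eq))
  ... | inj₂ y = let (k , t) = remQuot {m′} n y in
    trans (cong (λ t′ → (n * 2) ↑ʳ combine k t′) (turn-involutive (toℕ k) t))
          (trans (cong ((n * 2) ↑ʳ_) (combine-remQuot {m′} n y)) (splitAt⁻¹-↑ʳ eq))

  enumeration : Fin N ↔ Cell
  enumeration = mk↔ₛ′ cell index cell-index index-cell

  toℕ-index-upper : ∀ a c → toℕ (index (a ↑ˡ m′ , c)) ≡ toℕ (combine {n} {2} c a)
  toℕ-index-upper a c = trans (cong toℕ (index-upper a c)) (toℕ-↑ˡ _ (m′ * n))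

  toℕ-index-lower : ∀ k c → toℕ (index (2 ↑ʳ k , c)) ≡ n * 2 + toℕ (combine k (turn (toℕ k) c))
  toℕ-index-lower k c = toℕ-↑ʳ (n * 2) _

  data RowView : Fin (2 + m′) → Set where
    upper : (a : Fin 2) → RowView (a ↑ˡ m′)
    lower : (k : Fin m′) → RowView (2 ↑ʳ k)

  rowView : ∀ r → RowView r
  rowView zero          = upper 0F
  rowView (suc zero)    = upper 1F
  rowView (suc (suc k)) = lower k

  upper-step : ∀ {a a′ : Fin 2} {c c′ : Fin n} → toℕ (combine c′ a′) ≡ suc (toℕ (combine c a))
             → Near (toℕ a) (toℕ a′) × Near (toℕ c) (toℕ c′)
  upper-step {a} {a′} {c} {c′} e with combine-suc c c′ a a′ e
  ... | inj₁ (c′≡c , a′≡a+1)          = inj₂ (inj₁ (sym a′≡a+1)) , inj₁ (sym c′≡c)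
  ... | inj₂ (c′≡c+1 , a′≡0 , a+1≡2) =
    inj₂ (inj₂ (trans (cong suc a′≡0) (sym (suc-injective a+1≡2)))) , inj₂ (inj₁ (sym c′≡c+1))

  lower-step : ∀ {k k′ : Fin m′} {c c′ : Fin n}
             → toℕ (combine k′ (turn (toℕ k′) c′)) ≡ suc (toℕ (combine k (turn (toℕ k) c)))
             → Near (toℕ k) (toℕ k′) × Near (toℕ c) (toℕ c′)
  lower-step {k} {k′} {c} {c′} e with combine-suc k k′ (turn (toℕ k) c) (turn (toℕ k′) c′) e
  ... | inj₁ (k′≡k , t′≡t+1) =
    inj₁ (sym k′≡k)
    , inj₂ (turn-pathAdj⁻ (toℕ k) (inj₁ (sym (subst (λ κ → toℕ (turn κ c′) ≡ _) k′≡k t′≡t+1))))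
  ... | inj₂ (k′≡k+1 , t′≡0 , t+1≡n) = inj₂ (inj₁ (sym k′≡k+1)) , inj₁ (cong toℕ same-column)
    where
    same-column : c ≡ c′
    same-column = turn-injective (toℕ k) (toℕ-injective (suc-injective
      (trans t+1≡n (sym (opposite-zero⇒last (subst (λ κ → toℕ (turn κ c′) ≡ 0) k′≡k+1 t′≡0))))))

  upper-lower-step : ∀ {a : Fin 2} {c c′ : Fin n} {k : Fin m′}
                   → n * 2 + toℕ (combine k (turn (toℕ k) c′)) ≡ suc (toℕ (combine c a))
                   → Near (toℕ a) (2 + toℕ k) × Near (toℕ c) (toℕ c′)
  upper-lower-step {a} {c} {c′} {k} e =
      inj₂ (inj₁ (trans (proj₂ upper-last) (cong (2 +_) (sym (proj₁ lower-first)))))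
    , inj₁ (suc-injective (trans (proj₁ upper-last) (sym (opposite-zero⇒last
        (subst (λ κ → toℕ (turn κ c′) ≡ 0) (proj₁ lower-first) (proj₂ lower-first))))))
    where
    X = toℕ (combine k (turn (toℕ k) c′))

    X≡0 : X ≡ 0
    X≡0 = n≤0⇒n≡0 (+-cancelˡ-≤ (n * 2) X 0 (begin
      n * 2 + X                ≡⟨ e ⟩
      suc (toℕ (combine c a))  ≤⟨ toℕ<n (combine c a) ⟩
      n * 2                    ≡⟨ +-identityʳ _ ⟨
      n * 2 + 0                ∎))
      where open ≤-Reasoning

    upper-last : suc (toℕ c) ≡ n × suc (toℕ a) ≡ 2
    upper-last = combine-last c a (trans (sym e) (trans (cong (n * 2 +_) X≡0) (+-identityʳ _)))

    lower-first : toℕ k ≡ 0 × toℕ (turn (toℕ k) c′) ≡ 0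
    lower-first = combine-first k (turn (toℕ k) c′) X≡0

  lower-upper-impossible : ∀ {a′ : Fin 2} {c′ : Fin n} {X} → toℕ (combine c′ a′) ≢ suc (n * 2 + X)
  lower-upper-impossible {a′} {c′} {X} e =
    <⇒≱ (toℕ<n (combine c′ a′)) (≤-trans (m≤m+n (n * 2) X) (≤-trans (n≤1+n _) (≤-reflexive (sym e))))

  step-near : ∀ {u v} → toℕ (index v) ≡ suc (toℕ (index u))
            → Near (toℕ (proj₁ u)) (toℕ (proj₁ v)) × Near (toℕ (proj₂ u)) (toℕ (proj₂ v))
  step-near {r , c} {r′ , c′} e with rowView r | rowView r′
  ... | upper a | upper a′ = map₁ (subst₂ Near (sym (toℕ-↑ˡ a m′)) (sym (toℕ-↑ˡ a′ m′)))
    (upper-step (trans (sym (toℕ-index-upper a′ c′)) (trans e (cong suc (toℕ-index-upper a c)))))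
  ... | upper a | lower k′ = map₁ (subst (λ x → Near x _) (sym (toℕ-↑ˡ a m′)))
    (upper-lower-step (trans (sym (toℕ-index-lower k′ c′)) (trans e (cong suc (toℕ-index-upper a c)))))
  ... | lower k | upper a′ = ⊥-elim (lower-upper-impossible {a′} {c′}
    (trans (sym (toℕ-index-upper a′ c′)) (trans e (cong suc (toℕ-index-lower k c)))))
  ... | lower k | lower k′ = map₁ (Sum.map (cong (2 +_)) (Sum.map (cong (2 +_)) (cong (2 +_))))
    (lower-step (+-cancelˡ-≡ (n * 2) _ _ (trans (sym (toℕ-index-lower k′ c′))
      (trans e (trans (cong suc (toℕ-index-lower k c)) (sym (+-suc (n * 2) _)))))))

  consecutive-adjacent : ∀ {u v} → toℕ (index v) ≡ suc (toℕ (index u)) → Adj PP u v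
  consecutive-adjacent {u} {v} e = u≢v , near⇒close (proj₁ near) , near⇒close (proj₂ near)
    where
    near = step-near {u} {v} e

    u≢v : u ≢ v
    u≢v refl = <-irrefl e (n<1+n _)

  cell-at : ∀ {i} v → toℕ i ≡ toℕ (index v) → cell i ≡ v
  cell-at v e = trans (cong cell (toℕ-injective e)) (cell-index v)

  step-adjacent : ∀ {i j} → Step (toℕ i) (toℕ j) → Adj PP (cell i) (cell j)
  step-adjacent {i} {j} (inj₁ i+1≡j) =
    consecutive-adjacent (trans (cong toℕ (index-cell j)) (sym (trans (cong (suc ∘ toℕ) (index-cell i)) i+1≡j)))
  step-adjacent (inj₂ (i≡1 , j≡3)) =
    subst₂ (Adj PP) (sym (cell-at (1F , 0F) i≡1)) (sym (cell-at (1F , 1F) j≡3))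
      ((λ ()) , inj₁ refl , inj₂ (inj₁ refl))

  link-adjacent : ∀ {i j} → Link (toℕ i) (toℕ j) → Adj PP (cell i) (cell j)
  link-adjacent (inj₁ s) = step-adjacent s
  link-adjacent (inj₂ s) = path⊠path-sym (step-adjacent s)

  supergraph-distinguishing : (R : Cell → Cell → Set) → (∀ {u v} → Adj PP u v → R u v)
                            → 6 ≤ N → HasDistinguishingEdgeLabeling (record { V = Cell ; Adj = R }) 2
  supergraph-distinguishing R PP⊆R 6≤N =
    asymmetric-spanning⇒distinguishing₂ (ChordedPath N) _ (λ i j → link? (toℕ i) (toℕ j)) link-sym
      (chordedPath-asymmetric 6≤N) enumeration (PP⊆R ∘ link-adjacent)

6≤cells : ∀ m′ n′ → ¬ (m′ ≡ 0 × n′ ≡ 0) → 6 ≤ Grid.N m′ n′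
6≤cells zero     zero     not-2×2 = ⊥-elim (not-2×2 (refl , refl))
6≤cells m′       (suc n′) _       = s≤s (s≤s (s≤s (s≤s (s≤s (s≤s z≤n)))))
6≤cells (suc m′) zero     _       = s≤s (s≤s (s≤s (s≤s (s≤s (s≤s z≤n)))))

P⊠P-distinguishing : ∀ m′ n′ → 6 ≤ Grid.N m′ n′
                   → HasDistinguishingEdgeLabeling (P (2 + m′) ⊠ P (2 + n′)) 2
P⊠P-distinguishing m′ n′ = Grid.supergraph-distinguishing m′ n′ _ λ a → a

C⊠C-distinguishing : ∀ m′ n′ → 6 ≤ Grid.N m′ n′
                   → HasDistinguishingEdgeLabeling (C (2 + m′) ⊠ C (2 + n′)) 2
C⊠C-distinguishing m′ n′ =
  Grid.supergraph-distinguishing m′ n′ _ λ (u≢v , r , c) → u≢v , path⊆cycle r , path⊆cycle c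

P⊠C-distinguishing : ∀ m′ n′ → 6 ≤ Grid.N m′ n′
                   → HasDistinguishingEdgeLabeling (P (2 + m′) ⊠ C (2 + n′)) 2
P⊠C-distinguishing m′ n′ = Grid.supergraph-distinguishing m′ n′ _ λ (u≢v , r , c) → u≢v , r , path⊆cycle c

-- The complete graph K₄ = P₂ ⊠ P₂

Exhaustible : Set → Set₁
Exhaustible A = ∀ {P : A → Set} → (∀ a → Dec (P a)) → Dec (∀ a → P a)

Searchable : Set → Set₁
Searchable A = ∀ {P : A → Set} → (∀ a → Dec (P a)) → Dec (∃ P)

×-exhaustible : ∀ {A B} → Exhaustible A → Exhaustible B → Exhaustible (A × B)
×-exhaustible ∀A ∀B P? = map′ uncurry curry (∀A λ a → ∀B λ b → P? (a , b))

×-searchable : ∀ {A B} → Searchable A → Searchable B → Searchable (A × B)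
×-searchable ∃A ∃B P? =
  map′ (λ (a , b , p) → (a , b) , p) (λ ((a , b) , p) → a , b , p) (∃A λ a → ∃B λ b → P? (a , b))

K₄ : Graph
K₄ = P 2 ⊠ P 2

Corner : Set
Corner = Fin 2 × Fin 2

_≟_ : (u v : Corner) → Dec (u ≡ v)
_≟_ = ≡-dec _≟ᶠ_ _≟ᶠ_

corner-exhaustible : Exhaustible Corner
corner-exhaustible = ×-exhaustible all? all?

corner-searchable : Searchable Corner
corner-searchable = ×-searchable any? any?

close₂ : (a b : Fin 2) → Close 2 a b
close₂ 0F 0F = inj₁ refl
close₂ 0F 1F = inj₂ (inj₁ refl)
close₂ 1F 0F = inj₂ (inj₂ refl)
close₂ 1F 1F = inj₁ refl

K₄-complete : ∀ {u v} → u ≢ v → Adj K₄ u v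
K₄-complete {a , b} {c , d} u≢v = u≢v , close₂ a c , close₂ b d

Table : Set
Table = Corner × Corner × Corner × Corner

apply : Table → Corner → Corner
apply (x , _ , _ , _) (0F , 0F) = x
apply (_ , x , _ , _) (0F , 1F) = x
apply (_ , _ , x , _) (1F , 0F) = x
apply (_ , _ , _ , x) (1F , 1F) = x

tableOf : (Corner → Corner) → Table
tableOf π = π (0F , 0F) , π (0F , 1F) , π (1F , 0F) , π (1F , 1F)

apply-tableOf : ∀ π v → apply (tableOf π) v ≡ π v
apply-tableOf π (0F , 0F) = refl
apply-tableOf π (0F , 1F) = refl
apply-tableOf π (1F , 0F) = refl
apply-tableOf π (1F , 1F) = refl

table-exhaustible : Exhaustible Table
table-exhaustible = ×-exhaustible corner-exhaustible (×-exhaustible corner-exhaustible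
                      (×-exhaustible corner-exhaustible corner-exhaustible))

table-searchable : Searchable Table
table-searchable = ×-searchable corner-searchable (×-searchable corner-searchable
                     (×-searchable corner-searchable corner-searchable))

Colouring : ℕ → Set
Colouring d = Fin d × Fin d × Fin d × Fin d × Fin d × Fin d

colouring-exhaustible : ∀ {d} → Exhaustible (Colouring d)
colouring-exhaustible = ×-exhaustible all? (×-exhaustible all? (×-exhaustible all?
                          (×-exhaustible all? (×-exhaustible all? all?))))

colour : ∀ {d} → Colouring (suc d) → Corner → Corner → Fin (suc d)
colour (x , _ , _ , _ , _ , _) (0F , 0F) (0F , 1F) = x
colour (_ , x , _ , _ , _ , _) (0F , 0F) (1F , 0F) = x
colour (_ , _ , x , _ , _ , _) (0F , 0F) (1F , 1F) = x
colour (_ , _ , _ , x , _ , _) (0F , 1F) (1F , 0F) = x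
colour (_ , _ , _ , _ , x , _) (0F , 1F) (1F , 1F) = x
colour (_ , _ , _ , _ , _ , x) (1F , 0F) (1F , 1F) = x
colour (x , _ , _ , _ , _ , _) (0F , 1F) (0F , 0F) = x
colour (_ , x , _ , _ , _ , _) (1F , 0F) (0F , 0F) = x
colour (_ , _ , x , _ , _ , _) (1F , 1F) (0F , 0F) = x
colour (_ , _ , _ , x , _ , _) (1F , 0F) (0F , 1F) = x
colour (_ , _ , _ , _ , x , _) (1F , 1F) (0F , 1F) = x
colour (_ , _ , _ , _ , _ , x) (1F , 1F) (1F , 0F) = x
colour _                       _         _         = 0F

colouringOf : ∀ {d} → EdgeLabeling K₄ d → Colouring d
colouringOf c = lab c (0F , 0F) (0F , 1F) , lab c (0F , 0F) (1F , 0F) , lab c (0F , 0F) (1F , 1F)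
              , lab c (0F , 1F) (1F , 0F) , lab c (0F , 1F) (1F , 1F) , lab c (1F , 0F) (1F , 1F)

lab-colour : ∀ {d} (c : EdgeLabeling K₄ (suc d)) {u v} → u ≢ v → lab c u v ≡ colour (colouringOf c) u v
lab-colour c {0F , 0F} {0F , 0F} u≢v = ⊥-elim (u≢v refl)
lab-colour c {0F , 0F} {0F , 1F} _   = refl
lab-colour c {0F , 0F} {1F , 0F} _   = refl
lab-colour c {0F , 0F} {1F , 1F} _   = refl
lab-colour c {0F , 1F} {0F , 0F} u≢v = lab-sym c _ _ (K₄-complete u≢v)
lab-colour c {0F , 1F} {0F , 1F} u≢v = ⊥-elim (u≢v refl)
lab-colour c {0F , 1F} {1F , 0F} _   = refl
lab-colour c {0F , 1F} {1F , 1F} _   = refl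
lab-colour c {1F , 0F} {0F , 0F} u≢v = lab-sym c _ _ (K₄-complete u≢v)
lab-colour c {1F , 0F} {0F , 1F} u≢v = lab-sym c _ _ (K₄-complete u≢v)
lab-colour c {1F , 0F} {1F , 0F} u≢v = ⊥-elim (u≢v refl)
lab-colour c {1F , 0F} {1F , 1F} _   = refl
lab-colour c {1F , 1F} {0F , 0F} u≢v = lab-sym c _ _ (K₄-complete u≢v)
lab-colour c {1F , 1F} {0F , 1F} u≢v = lab-sym c _ _ (K₄-complete u≢v)
lab-colour c {1F , 1F} {1F , 0F} u≢v = lab-sym c _ _ (K₄-complete u≢v)
lab-colour c {1F , 1F} {1F , 1F} u≢v = ⊥-elim (u≢v refl)

Involutive : Table → Set
Involutive τ = ∀ v → apply τ (apply τ v) ≡ v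

Moves : Table → Set
Moves τ = ∃ λ v → apply τ v ≢ v

PreservesColour : ∀ {d} → Colouring (suc d) → Table → Set
PreservesColour κ τ = ∀ u v → u ≢ v → colour κ (apply τ u) (apply τ v) ≡ colour κ u v

involutive? : ∀ τ → Dec (Involutive τ)
involutive? τ = corner-exhaustible λ v → apply τ (apply τ v) ≟ v

moves? : ∀ τ → Dec (Moves τ)
moves? τ = corner-searchable λ v → ¬? (apply τ v ≟ v)

preservesColour? : ∀ {d} κ τ → Dec (PreservesColour {d} κ τ)
preservesColour? κ τ = corner-exhaustible λ u → corner-exhaustible λ v →
  ¬? (u ≟ v) →-dec (colour κ (apply τ u) (apply τ v) ≟ᶠ colour κ u v)

-- Opaque, so that the large proof terms produced by evaluating these decisions are
-- never unfolded where the lemmas are used.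
opaque
  every-2-colouring-has-symmetry : ∀ (κ : Colouring 2) → ∃ λ τ → Involutive τ × Moves τ × PreservesColour κ τ
  every-2-colouring-has-symmetry = toWitness {a? = colouring-exhaustible λ κ →
    table-searchable λ τ → involutive? τ ×-dec moves? τ ×-dec preservesColour? κ τ} _

K₄-no-distinguishing₂ : ¬ HasDistinguishingEdgeLabeling K₄ 2
K₄-no-distinguishing₂ (c , distinguishing)
  with τ , τ-involutive , (v , moved) , preserved ← every-2-colouring-has-symmetry (colouringOf c)
  = moved (distinguishing α α-preserves v)
  where
  distinct : ∀ {u w} → u ≢ w → apply τ u ≢ apply τ w
  distinct u≢w e = u≢w (trans (sym (τ-involutive _)) (trans (cong (apply τ) e) (τ-involutive _)))

  α : Automorphism K₄
  α = involution K₄ (apply τ) τ-involutive λ (u≢w , _) → K₄-complete (distinct u≢w)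

  α-preserves : Preserves α c
  α-preserves u w (u≢w , _) =
    trans (lab-colour c (distinct u≢w)) (trans (preserved u w u≢w) (sym (lab-colour c u≢w)))

-- The edge (0,0)(0,1) alone carries label 2 and (0,0)(1,0) alone label 1, so (0,0) is
-- fixed, then the other two endpoints, then the last corner.
κ₃ : Colouring 3
κ₃ = 2F , 1F , 0F , 0F , 0F , 0F

labeling₃ : EdgeLabeling K₄ 3
labeling₃ = record
  { lab     = colour κ₃
  ; lab-sym = λ u v _ → toWitness {a? = corner-exhaustible λ u → corner-exhaustible λ v →
                                          colour κ₃ u v ≟ᶠ colour κ₃ v u} _ u v
  }

opaque
  κ₃-rigid : ∀ τ → (∀ u v → apply τ u ≡ apply τ v → u ≡ v) → PreservesColour κ₃ τ
           → ∀ v → apply τ v ≡ v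
  κ₃-rigid = toWitness {a? = table-exhaustible λ τ →
    (corner-exhaustible λ u → corner-exhaustible λ v → (apply τ u ≟ apply τ v) →-dec (u ≟ v))
    →-dec preservesColour? κ₃ τ →-dec corner-exhaustible λ v → apply τ v ≟ v} _

labeling₃-distinguishing : Distinguishing labeling₃
labeling₃-distinguishing f preserves v =
  trans (sym (apply-tableOf (to f) v)) (κ₃-rigid (tableOf (to f)) injective preserved v)
  where
  injective : ∀ u w → apply (tableOf (to f)) u ≡ apply (tableOf (to f)) w → u ≡ w
  injective u w e = to-injective f (trans (sym (apply-tableOf (to f) u)) (trans e (apply-tableOf (to f) w)))

  preserved : PreservesColour κ₃ (tableOf (to f))
  preserved u w u≢w = trans (cong₂ (colour κ₃) (apply-tableOf (to f) u) (apply-tableOf (to f) w))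
                            (preserves u w (K₄-complete u≢w))

K₄-index≡3 : DistinguishingIndexIs K₄ 3
K₄-index≡3 = (labeling₃ , labeling₃-distinguishing) , at-least-3
  where
  at-least-3 : ∀ d → HasDistinguishingEdgeLabeling K₄ d → 3 ≤ d
  at-least-3 d h with m≤n⇒m<n∨m≡n (moved⇒2≤labels (⊠-mapˡ (P 2) (reverse-path 2)) {0F , 0F} (λ ()) h)
  ... | inj₁ 2<d  = 2<d
  ... | inj₂ refl = ⊥-elim (K₄-no-distinguishing₂ h)

mainTheorem5 : ((∀ (m n : ℕ) → 2 ≤ m → 2 ≤ n → ¬ (m ≡ 2 × n ≡ 2) → DistinguishingIndexIs (P m ⊠ P n) 2)
      × DistinguishingIndexIs (P 2 ⊠ P 2) 3)
    × (∀ (m n : ℕ) → 3 ≤ m → 3 ≤ n → DistinguishingIndexIs (C m ⊠ C n) 2)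
    × (∀ (m n : ℕ) → 2 ≤ m → 3 ≤ n → DistinguishingIndexIs (P m ⊠ C n) 2)
mainTheorem5 = (paths , K₄-index≡3) , cycles , path-cycle
  where
  paths : ∀ m n → 2 ≤ m → 2 ≤ n → ¬ (m ≡ 2 × n ≡ 2) → DistinguishingIndexIs (P m ⊠ P n) 2
  paths (suc (suc m′)) (suc (suc n′)) (s≤s (s≤s _)) (s≤s (s≤s _)) not-K₄ =
    distinguishingIndex≡2
      (P⊠P-distinguishing m′ n′ (6≤cells m′ n′ λ { (refl , refl) → not-K₄ (refl , refl) }))
      (⊠-mapˡ (P (2 + n′)) (reverse-path (2 + m′))) {0F , 0F} λ ()

  cycles : ∀ m n → 3 ≤ m → 3 ≤ n → DistinguishingIndexIs (C m ⊠ C n) 2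
  cycles (suc (suc (suc m′))) (suc (suc (suc n′))) (s≤s (s≤s (s≤s _))) (s≤s (s≤s (s≤s _))) =
    distinguishingIndex≡2
      (C⊠C-distinguishing (suc m′) (suc n′) (6≤cells (suc m′) (suc n′) λ { (() , _) }))
      (⊠-mapˡ (C (3 + n′)) (reverse-cycle (3 + m′))) {0F , 0F} λ ()

  path-cycle : ∀ m n → 2 ≤ m → 3 ≤ n → DistinguishingIndexIs (P m ⊠ C n) 2
  path-cycle (suc (suc m′)) (suc (suc (suc n′))) (s≤s (s≤s _)) (s≤s (s≤s (s≤s _))) =
    distinguishingIndex≡2
      (P⊠C-distinguishing m′ (suc n′) (6≤cells m′ (suc n′) λ { (_ , ()) }))
      (⊠-mapˡ (C (3 + n′)) (reverse-path (2 + m′))) {0F , 0F} λ ()
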